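{- Let $p\geq 0$ and $k\geq 2$ be integers, let $T$ be a finite tree with maximum degree $\Delta(T)\leq 3$, and let $X\subseteq V(T)$ be a set of at least $(2p+1)(k-1)$ vertices each of degree at most $2$ in $T$. Then there are pairwise disjoint subtrees $T_1,\dots,T_p\subseteq T$ such that $|V(T_i)\cap X|\geq k$ for every $i\in\{1,\dots,p\}$. -}

module Defs where

open import Data.Nat using (ℕ; _≤_)
open import Data.Bool using (Bool; true; false)
open import Data.Fin using (Fin)
open import Data.Fin.Subset using (Subset; _∈_; ∣_∣; Nonempty)
open import Data.Vec using (tabulate)
open import Data.List using (List; []; _∷_; _∷ʳ_; length)
open import Data.List.Relation.Unary.All using (All)
open import Data.List.Relation.Unary.Linked using (Linked)
open import Data.List.Relation.Unary.Unique.Propositional using (Unique)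
open import Data.Product using (_×_)
open import Relation.Binary.PropositionalEquality using (_≡_)
open import Relation.Nullary using (¬_)

EdgeRel : ℕ → Set
EdgeRel n = Fin n → Fin n → Bool

IsSimpleGraph : ∀ {n} → EdgeRel n → Set
IsSimpleGraph E = (∀ i j → E i j ≡ E j i) × (∀ i → E i i ≡ false)

deg : ∀ {n} → EdgeRel n → Fin n → ℕ
deg E i = ∣ tabulate (E i) ∣

data Walk {n} (S : Subset n) (F : EdgeRel n) : Fin n → Fin n → Set where
  here : ∀ {u} → u ∈ S → Walk S F u u
  step : ∀ {u w v} → u ∈ S → F u w ≡ true → Walk S F w v → Walk S F u v

Connected : ∀ {n} → Subset n → EdgeRel n → Set
Connected S F = ∀ u v → u ∈ S → v ∈ S → Walk S F u v

record Cycle {n} (S : Subset n) (F : EdgeRel n) : Set where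
  field
    x        : Fin n
    xs       : List (Fin n)
    long     : 2 ≤ length xs
    distinct : Unique (x ∷ xs)
    inS      : All (_∈ S) (x ∷ xs)
    closed   : Linked (λ a b → F a b ≡ true) ((x ∷ xs) ∷ʳ x)

Acyclic : ∀ {n} → Subset n → EdgeRel n → Set
Acyclic S F = ¬ Cycle S F

IsTree : ∀ {n} → Subset n → EdgeRel n → Set
IsTree S F = Nonempty S × Connected S F × Acyclic S F

IsSubgraph : ∀ {n} → EdgeRel n → Subset n → EdgeRel n → Set
IsSubgraph E S F =
  (∀ i j → F i j ≡ true → E i j ≡ true) ×
  (∀ i j → F i j ≡ F j i) ×
  (∀ i j → F i j ≡ true → i ∈ S × j ∈ S)

-- Root a spanning tree of T and cut pieces greedily from the leaves up, with K = k - 1.  A vertex v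
-- gathers its own X-weight and the uncut remainders of its children, each of weight at most K, and
-- the subtree so formed is cut off as a piece as soon as its weight reaches k.  A non-root vertex has
-- at most 2 - [v ∈ X] children (Δ ≤ 3, one edge leads to the parent, and vertices of X have degree
-- at most 2), so every piece weighs at most 2K; at the root there may be one child more, so the
-- last piece weighs at most 3K, or else the final remainder at most K.  Hence
-- |X| ≤ (2·#pieces + 1)K, and (2p + 1)K ≤ |X| leaves at least p disjoint pieces.
module Submission where

open import Defs
open import Data.Nat using (ℕ; zero; suc; _≤_; _<_; _*_; _+_; _∸_; z≤n; s≤s; _≤?_; NonZero)
open import Data.Nat.Properties
  using (≤-refl; ≤-trans; <⇒≱; ≤-<-trans; m≤n⇒m≤1+n; ≤-pred; ≰⇒>; m<m+n; m≤m*n;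
         +-suc; +-comm; +-identityʳ; +-monoˡ-≤; +-monoʳ-≤; +-mono-≤; +-cancelʳ-≤; +-commutativeSemigroup;
         *-monoˡ-≤; *-distribʳ-+; *-cancelʳ-≤; *-cancelˡ-≤; module ≤-Reasoning)
open import Data.Nat.Tactic.RingSolver using (solve-∀)
open import Algebra.Properties.CommutativeSemigroup +-commutativeSemigroup
  using (x∙yz≈y∙xz) renaming (interchange to +-interchange)
open import Data.Bool using (Bool; true; _∧_)
open import Data.Bool.Properties using (∧-comm)
open import Data.Fin using (Fin; zero; suc; inject≤; _≟_)
open import Data.Fin.Properties using (all?; ¬∀⟶∃¬; inject≤-injective)
open import Data.Fin.Subset using (Subset; ⊤; _∈_; _⊆_; _∩_; _-_; ∣_∣; Empty; Nonempty; inside; outside)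
open import Data.Fin.Subset.Properties
  using (∈⊤; ∣⊤∣≡n; x∈p⇒∣p-x∣<∣p∣; x∈p∧x≢y⇒x∈p-y; x∈p∩q⁺; x∈p∩q⁻)
  renaming (_∈?_ to _∈ˢ?_)
open import Data.Vec as Vec using (tabulate; lookup; here; there)
open import Data.Vec.Properties using (lookup⇒[]=; []=⇒lookup; lookup∘tabulate)
open import Data.List using (List; []; _∷_; _++_; [_]; length; map; filter)
import Data.List as List
open import Data.List.Properties using (++-assoc; ++-identityʳ; length-++; length-map; filter-++)
open import Data.List.Membership.Propositional using () renaming (_∈_ to _∈ₗ_)
open import Data.List.Membership.Propositional.Properties
  using (∈-++⁻; ∈-++⁺ˡ; ∈-++⁺ʳ; ∈-filter⁺; ∈-filter⁻; ∈-lookup)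
open import Data.List.Relation.Unary.All as All using (All; []; _∷_)
import Data.List.Relation.Unary.All.Properties as All
open import Data.List.Relation.Unary.Any using (here; there; any?)
open import Data.List.Relation.Unary.AllPairs using ([]; _∷_)
open import Data.List.Relation.Unary.Linked as Linked using ()
open import Data.List.Relation.Unary.Unique.Propositional using (Unique)
import Data.List.Relation.Unary.Unique.Propositional.Properties as Unique
open import Data.List.Relation.Binary.Disjoint.Propositional using (Disjoint)
open import Data.List.Relation.Binary.Permutation.Propositional
  using (_↭_; ↭-refl; ↭-reflexive; ↭-prep; ↭-swap; ↭-trans; ↭-sym; ↭⇒↭ₛ)
open import Data.List.Relation.Binary.Permutation.Propositional.Properties
  using (↭-length; shift; ++⁺; ++⁺ˡ; ++⁺ʳ; ++-comm; ++-commutativeMonoid)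
import Data.List.Relation.Binary.Permutation.Setoid.Properties as Permutationₛ
open import Algebra.Bundles using (CommutativeMonoid)
open import Data.Product using (Σ; ∃₂; _×_; _,_; proj₁; proj₂)
open import Data.Sum using (inj₁; inj₂)
open import Data.Empty using (⊥-elim)
open import Function using (_∘_)
open import Relation.Nullary using (¬_; Dec; yes; no; does)
open import Relation.Nullary.Decidable using (dec-true)
open import Relation.Unary using (Pred; Decidable)
open import Relation.Binary.PropositionalEquality
  using (_≡_; _≢_; refl; sym; trans; cong; cong₂; subst; setoid)

+-≤-scale : ∀ x l d K .{{_ : NonZero K}} → x + l ≤ d → x + l * K ≤ d * K
+-≤-scale x l d K x+l≤d = begin
  x + l * K      ≤⟨ +-monoˡ-≤ (l * K) (m≤m*n x K) ⟩
  x * K + l * K  ≡⟨ *-distribʳ-+ K x l ⟨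
  (x + l) * K    ≤⟨ *-monoˡ-≤ K x+l≤d ⟩
  d * K          ∎
  where open ≤-Reasoning

+-≤-absorb : ∀ {x y a r d} → y ≤ a + r → x + r ≤ d → x + y ≤ a + d
+-≤-absorb {x} {y} {a} {r} {d} y≤a+r x+r≤d = begin
  x + y        ≤⟨ +-monoʳ-≤ x y≤a+r ⟩
  x + (a + r)  ≡⟨ x∙yz≈y∙xz x a r ⟩
  a + (x + r)  ≤⟨ +-monoʳ-≤ a x+r≤d ⟩
  a + d        ∎
  where open ≤-Reasoning

[2p+1]*K≤[2q+1]*K⇒p≤q : ∀ p q K .{{_ : NonZero K}} → (2 * p + 1) * K ≤ (2 * q + 1) * K → p ≤ q
[2p+1]*K≤[2q+1]*K⇒p≤q p q K le =
  *-cancelˡ-≤ 2 (+-cancelʳ-≤ 1 (2 * p) (2 * q) (*-cancelʳ-≤ (2 * p + 1) (2 * q + 1) K le))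

Unique-resp-↭ : ∀ {A : Set} {xs ys : List A} → xs ↭ ys → Unique xs → Unique ys
Unique-resp-↭ p = Permutationₛ.Unique-resp-↭ (setoid _) (↭⇒↭ₛ p)

module _ {A : Set} where

  Unique-++⁻ : ∀ (xs : List A) {ys} → Unique (xs ++ ys) → Unique xs × Unique ys × Disjoint xs ys
  Unique-++⁻ [] u = [] , u , λ ()
  Unique-++⁻ (x ∷ xs) (x∉ ∷ u) with Unique-++⁻ xs u
  ... | uxs , uys , disjoint = All.++⁻ˡ xs x∉ ∷ uxs , uys , λ where
    (here refl , x∈ys) → All.lookup (All.++⁻ʳ xs x∉) x∈ys refl
    (there v∈xs , v∈ys) → disjoint (v∈xs , v∈ys)

  Unique-∷-++⁻ : ∀ v (xs : List A) {ys} → Unique (v ∷ xs ++ ys) → Unique (v ∷ xs) × Unique (v ∷ ys)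
  Unique-∷-++⁻ v xs (v∉ ∷ u) with Unique-++⁻ xs u
  ... | uxs , uys , _ = (All.++⁻ˡ xs v∉ ∷ uxs) , (All.++⁻ʳ xs v∉ ∷ uys)

_∈ₗ?_ : ∀ {n} (x : Fin n) (xs : List (Fin n)) → Dec (x ∈ₗ xs)
x ∈ₗ? xs = any? (x ≟_) xs

module _ {n : ℕ} where

  unique⇒length≤∣p∣ : ∀ {p : Subset n} {xs} → Unique xs → All (_∈ p) xs → length xs ≤ ∣ p ∣
  unique⇒length≤∣p∣ [] [] = z≤n
  unique⇒length≤∣p∣ {p} {x ∷ xs} (x∉ ∷ u) (x∈p ∷ xs⊆p) =
    ≤-<-trans (unique⇒length≤∣p∣ u xs⊆p-x) (x∈p⇒∣p-x∣<∣p∣ x∈p)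
    where
      xs⊆p-x : All (_∈ p - x) xs
      xs⊆p-x = All.zipWith (λ (y∈p , x≢y) → x∈p∧x≢y⇒x∈p-y y∈p (x≢y ∘ sym)) (xs⊆p , x∉)

  ∈-tabulate⁺ : ∀ (f : Fin n → Bool) {i} → f i ≡ true → i ∈ tabulate f
  ∈-tabulate⁺ f {i} fi = lookup⇒[]= i (tabulate f) (trans (lookup∘tabulate f i) fi)

  ∈-tabulate⁻ : ∀ (f : Fin n → Bool) {i} → i ∈ tabulate f → f i ≡ true
  ∈-tabulate⁻ f {i} i∈ = trans (sym (lookup∘tabulate f i)) ([]=⇒lookup i∈)

unsucs : ∀ {n} → List (Fin (suc n)) → List (Fin n)
unsucs [] = []
unsucs (zero ∷ xs) = unsucs xs
unsucs (suc x ∷ xs) = x ∷ unsucs xs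

length-unsucs : ∀ {n} (xs : List (Fin (suc n))) → length (unsucs xs) ≤ length xs
length-unsucs [] = z≤n
length-unsucs (zero ∷ xs) = m≤n⇒m≤1+n (length-unsucs xs)
length-unsucs (suc x ∷ xs) = s≤s (length-unsucs xs)

length-unsucs-< : ∀ {n} (xs : List (Fin (suc n))) → zero ∈ₗ xs → length (unsucs xs) < length xs
length-unsucs-< (zero ∷ xs) _ = s≤s (length-unsucs xs)
length-unsucs-< (suc x ∷ xs) (there 0∈xs) = s≤s (length-unsucs-< xs 0∈xs)

∈-unsucs : ∀ {n} {x : Fin n} (xs : List (Fin (suc n))) → suc x ∈ₗ xs → x ∈ₗ unsucs xs
∈-unsucs (zero ∷ xs) (there x∈xs) = ∈-unsucs xs x∈xs
∈-unsucs (suc y ∷ xs) (here refl) = here refl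
∈-unsucs (suc y ∷ xs) (there x∈xs) = there (∈-unsucs xs x∈xs)

∣p∣≤length : ∀ {n} (p : Subset n) (xs : List (Fin n)) →
             (∀ {x} → x ∈ p → x ∈ₗ xs) → ∣ p ∣ ≤ length xs
∣p∣≤length Vec.[] xs p⊆xs = z≤n
∣p∣≤length (outside Vec.∷ p) xs p⊆xs =
  ≤-trans (∣p∣≤length p (unsucs xs) (∈-unsucs xs ∘ p⊆xs ∘ there)) (length-unsucs xs)
∣p∣≤length (inside Vec.∷ p) xs p⊆xs =
  ≤-trans (s≤s (∣p∣≤length p (unsucs xs) (∈-unsucs xs ∘ p⊆xs ∘ there))) (length-unsucs-< xs (p⊆xs here))

module _ {n : ℕ} {S : Subset n} {F : EdgeRel n} where

  Walk-source : ∀ {u v} → Walk S F u v → u ∈ S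
  Walk-source (here u∈S) = u∈S
  Walk-source (step u∈S _ _) = u∈S

  Walk-++ : ∀ {u v w} → Walk S F u v → Walk S F v w → Walk S F u w
  Walk-++ (here _) q = q
  Walk-++ (step u∈S e p) q = step u∈S e (Walk-++ p q)

  Walk-reverse : (∀ i j → F i j ≡ F j i) → ∀ {u v} → Walk S F u v → Walk S F v u
  Walk-reverse F-sym (here u∈S) = here u∈S
  Walk-reverse F-sym {u} (step {w = w} u∈S e p) =
    Walk-++ (Walk-reverse F-sym p) (step (Walk-source p) (trans (F-sym w u) e) (here u∈S))

  Walk-exit : ∀ {ℓ} {P : Pred (Fin n) ℓ} → Decidable P → ∀ {u v} → Walk S F u v → P u → ¬ P v →
              ∃₂ λ a b → P a × ¬ P b × F a b ≡ true
  Walk-exit P? (here _) Pu ¬Pv = ⊥-elim (¬Pv Pu)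
  Walk-exit P? {u} (step {w = w} _ e p) Pu ¬Pv with P? w
  ... | yes Pw = Walk-exit P? p Pw ¬Pv
  ... | no ¬Pw = u , w , Pu , ¬Pw , e

Cycle-mono : ∀ {n} {S T : Subset n} {F E : EdgeRel n} →
             S ⊆ T → (∀ i j → F i j ≡ true → E i j ≡ true) → Cycle S F → Cycle T E
Cycle-mono S⊆T F⊆E c = record
  { x = x ; xs = xs ; long = long ; distinct = distinct
  ; inS = All.map S⊆T inS
  ; closed = Linked.map (F⊆E _ _) closed
  }
  where open Cycle c

data Rose (A : Set) : Set where
  node : A → List (Rose A) → Rose A

module _ {A : Set} where

  root : Rose A → A
  root (node v _) = v

  flatten : Rose A → List A
  flattenForest : List (Rose A) → List A
  flatten (node v ts) = v ∷ flattenForest ts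
  flattenForest [] = []
  flattenForest (t ∷ ts) = flatten t ++ flattenForest ts

  root∈flatten : ∀ t → root t ∈ₗ flatten t
  root∈flatten (node v ts) = here refl

  flattenForest-++ : ∀ ts us → flattenForest (ts ++ us) ≡ flattenForest ts ++ flattenForest us
  flattenForest-++ [] us = refl
  flattenForest-++ (t ∷ ts) us =
    trans (cong (flatten t ++_) (flattenForest-++ ts us)) (sym (++-assoc (flatten t) (flattenForest ts) _))

  flattenForest-[_] : ∀ t → flattenForest [ t ] ≡ flatten t
  flattenForest-[ t ] = ++-identityʳ (flatten t)

  root∈flattenForest : ∀ {x} ts → x ∈ₗ map root ts → x ∈ₗ flattenForest ts
  root∈flattenForest (t ∷ ts) (here refl) = ∈-++⁺ˡ (root∈flatten t)
  root∈flattenForest (t ∷ ts) (there x∈) = ∈-++⁺ʳ (flatten t) (root∈flattenForest ts x∈)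

  Unique-roots : ∀ ts → Unique (flattenForest ts) → Unique (map root ts)
  Unique-roots [] _ = []
  Unique-roots (t ∷ ts) u with Unique-++⁻ (flatten t) u
  ... | _ , uts , disjoint =
    All.tabulate (λ { x∈ refl → disjoint (root∈flatten t , root∈flattenForest ts x∈) })
    ∷ Unique-roots ts uts

  flatten-lookup⊆ : ∀ ts (i : Fin (length ts)) {x} →
                    x ∈ₗ flatten (List.lookup ts i) → x ∈ₗ flattenForest ts
  flatten-lookup⊆ (t ∷ ts) zero x∈ = ∈-++⁺ˡ x∈
  flatten-lookup⊆ (t ∷ ts) (suc i) x∈ = ∈-++⁺ʳ (flatten t) (flatten-lookup⊆ ts i x∈)

  Unique-flatten-lookup : ∀ ts → Unique (flattenForest ts) →
                          ∀ i → Unique (flatten (List.lookup ts i))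
  Unique-flatten-lookup (t ∷ ts) u zero = proj₁ (Unique-++⁻ (flatten t) u)
  Unique-flatten-lookup (t ∷ ts) u (suc i) =
    Unique-flatten-lookup ts (proj₁ (proj₂ (Unique-++⁻ (flatten t) u))) i

  Disjoint-flatten-lookup : ∀ ts → Unique (flattenForest ts) → ∀ i j → i ≢ j →
                            Disjoint (flatten (List.lookup ts i)) (flatten (List.lookup ts j))
  Disjoint-flatten-lookup (t ∷ ts) u zero zero i≢j = ⊥-elim (i≢j refl)
  Disjoint-flatten-lookup (t ∷ ts) u zero (suc j) _ (x∈t , x∈tj) =
    proj₂ (proj₂ (Unique-++⁻ (flatten t) u)) (x∈t , flatten-lookup⊆ ts j x∈tj)
  Disjoint-flatten-lookup (t ∷ ts) u (suc i) zero _ (x∈ti , x∈t) =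
    proj₂ (proj₂ (Unique-++⁻ (flatten t) u)) (x∈t , flatten-lookup⊆ ts i x∈ti)
  Disjoint-flatten-lookup (t ∷ ts) u (suc i) (suc j) i≢j =
    Disjoint-flatten-lookup ts (proj₁ (proj₂ (Unique-++⁻ (flatten t) u))) i j (i≢j ∘ cong suc)

data Along {n : ℕ} (E : EdgeRel n) : Rose (Fin n) → Set where
  node : ∀ {v ts} → All (λ t → E v (root t) ≡ true) ts → All (Along E) ts → Along E (node v ts)

module _ {A : Set} (w : A) where

  graft : ∀ {u} t → u ∈ₗ flatten t → Rose A
  graftForest : ∀ {u} ts → u ∈ₗ flattenForest ts → List (Rose A)
  graft (node v ts) (here _) = node v (node w [] ∷ ts)
  graft (node v ts) (there u∈) = node v (graftForest ts u∈)
  graftForest (t ∷ ts) u∈ with ∈-++⁻ (flatten t) u∈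
  ... | inj₁ u∈t = graft t u∈t ∷ ts
  ... | inj₂ u∈ts = t ∷ graftForest ts u∈ts

  root-graft : ∀ {u} t (u∈ : u ∈ₗ flatten t) → root (graft t u∈) ≡ root t
  root-graft (node v ts) (here _) = refl
  root-graft (node v ts) (there _) = refl

  flatten-graft : ∀ {u} t (u∈ : u ∈ₗ flatten t) → flatten (graft t u∈) ↭ w ∷ flatten t
  flattenForest-graft : ∀ {u} ts (u∈ : u ∈ₗ flattenForest ts) →
                        flattenForest (graftForest ts u∈) ↭ w ∷ flattenForest ts
  flatten-graft (node v ts) (here _) = ↭-swap v w ↭-refl
  flatten-graft (node v ts) (there u∈) =
    ↭-trans (↭-prep v (flattenForest-graft ts u∈)) (↭-swap v w ↭-refl)
  flattenForest-graft (t ∷ ts) u∈ with ∈-++⁻ (flatten t) u∈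
  ... | inj₁ u∈t = ++⁺ʳ (flattenForest ts) (flatten-graft t u∈t)
  ... | inj₂ u∈ts =
    ↭-trans (++⁺ˡ (flatten t) (flattenForest-graft ts u∈ts)) (shift w (flatten t) (flattenForest ts))

module _ {n : ℕ} (E : EdgeRel n) (w : Fin n) where

  Along-graft : ∀ {u} t (u∈ : u ∈ₗ flatten t) → E u w ≡ true → Along E t → Along E (graft w t u∈)
  Along-graftForest : ∀ {u v} ts (u∈ : u ∈ₗ flattenForest ts) → E u w ≡ true →
                      All (λ t → E v (root t) ≡ true) ts → All (Along E) ts →
                      All (λ t → E v (root t) ≡ true) (graftForest w ts u∈) ×
                      All (Along E) (graftForest w ts u∈)
  Along-graft (node v ts) (here refl) e (node adj along) = node (e ∷ adj) (node [] [] ∷ along)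
  Along-graft (node v ts) (there u∈) e (node adj along) with Along-graftForest ts u∈ e adj along
  ... | adj′ , along′ = node adj′ along′
  Along-graftForest (t ∷ ts) u∈ e (vt ∷ adj) (at ∷ along) with ∈-++⁻ (flatten t) u∈
  ... | inj₁ u∈t =
    (subst (λ r → E _ r ≡ true) (sym (root-graft w t u∈t)) vt ∷ adj) , (Along-graft t u∈t e at ∷ along)
  ... | inj₂ u∈ts with Along-graftForest ts u∈ts e adj along
  ...   | adj′ , along′ = (vt ∷ adj′) , (at ∷ along′)

module _ {n : ℕ} (E : EdgeRel n) where

  Spanning : Rose (Fin n) → Set
  Spanning t = Along E t × Unique (flatten t) × (∀ v → v ∈ₗ flatten t)

  -- t is duplicate-free, so n < f + |t| leaves room for at most f more vertices; f = 0 is absurd.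
  extend-to-spanning : Connected ⊤ E → (f : ℕ) (t : Rose (Fin n)) → Along E t → Unique (flatten t) →
                       n < f + length (flatten t) → Σ (Rose (Fin n)) Spanning
  extend-to-spanning conn zero t _ u n< = ⊥-elim (<⇒≱ n< (subst (length (flatten t) ≤_) (∣⊤∣≡n n) |t|≤∣⊤∣))
    where
      |t|≤∣⊤∣ : length (flatten t) ≤ ∣ ⊤ {n} ∣
      |t|≤∣⊤∣ = unique⇒length≤∣p∣ u (All.tabulate (λ _ → ∈⊤))
  extend-to-spanning conn (suc f) t along u n< with all? (_∈ₗ? flatten t)
  ... | yes spans = t , along , u , spans
  ... | no ¬spans with ¬∀⟶∃¬ n _ (_∈ₗ? flatten t) ¬spans
  ...   | v , v∉t with Walk-exit (_∈ₗ? flatten t) (conn (root t) v ∈⊤ ∈⊤) (root∈flatten t) v∉t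
  ...     | a , b , a∈t , b∉t , e =
    extend-to-spanning conn f (graft b t a∈t) (Along-graft E b t a∈t e along) unique
      (subst (n <_) length-grows n<)
    where
      unique : Unique (flatten (graft b t a∈t))
      unique = Unique-resp-↭ (↭-sym (flatten-graft b t a∈t)) (All.¬Any⇒All¬ (flatten t) b∉t ∷ u)

      length-grows : suc f + length (flatten t) ≡ f + length (flatten (graft b t a∈t))
      length-grows = sym (trans (cong (f +_) (↭-length (flatten-graft b t a∈t))) (+-suc f _))

  spanning-tree : Connected ⊤ E → Nonempty (⊤ {n}) → Σ (Rose (Fin n)) Spanning
  spanning-tree conn (r , _) =
    extend-to-spanning conn n (node r []) (node [] []) ([] ∷ []) (m<m+n n (s≤s z≤n))

module _ {n : ℕ} where

  fromList : List (Fin n) → Subset n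
  fromList xs = tabulate (λ i → does (i ∈ₗ? xs))

  ∈-fromList⁺ : ∀ {x xs} → x ∈ₗ xs → x ∈ fromList xs
  ∈-fromList⁺ {x} {xs} x∈ = ∈-tabulate⁺ (λ i → does (i ∈ₗ? xs)) (dec-true (x ∈ₗ? xs) x∈)

  ∈-fromList⁻ : ∀ {x xs} → x ∈ fromList xs → x ∈ₗ xs
  ∈-fromList⁻ {x} {xs} x∈ with x ∈ₗ? xs | ∈-tabulate⁻ (λ i → does (i ∈ₗ? xs)) x∈
  ... | yes x∈xs | _ = x∈xs

  restrict : EdgeRel n → Subset n → EdgeRel n
  restrict E S a b = E a b ∧ (lookup S a ∧ lookup S b)

  module _ {E : EdgeRel n} {S : Subset n} where

    restrict-⊆ : ∀ a b → restrict E S a b ≡ true → E a b ≡ true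
    restrict-⊆ a b e with E a b
    ... | true = refl

    restrict-ends : ∀ a b → restrict E S a b ≡ true → a ∈ S × b ∈ S
    restrict-ends a b e with E a b | lookup S a in Sa | lookup S b in Sb
    ... | true | true | true = lookup⇒[]= a S Sa , lookup⇒[]= b S Sb

    restrict⁺ : ∀ {a b} → E a b ≡ true → a ∈ S → b ∈ S → restrict E S a b ≡ true
    restrict⁺ e a∈S b∈S rewrite e | []=⇒lookup a∈S | []=⇒lookup b∈S = refl

    restrict-sym : (∀ i j → E i j ≡ E j i) → ∀ a b → restrict E S a b ≡ restrict E S b a
    restrict-sym E-sym a b rewrite E-sym a b = cong (E b a ∧_) (∧-comm (lookup S a) (lookup S b))

    IsSubgraph-restrict : (∀ i j → E i j ≡ E j i) → IsSubgraph E S (restrict E S)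
    IsSubgraph-restrict E-sym = restrict-⊆ , restrict-sym E-sym , restrict-ends

module _ {n : ℕ} {E : EdgeRel n} {S : Subset n} where

  walk-from-root : ∀ t → Along E t → (∀ {x} → x ∈ₗ flatten t → x ∈ S) →
                   ∀ {x} → x ∈ₗ flatten t → Walk S (restrict E S) (root t) x
  walk-from-parent : ∀ {v} ts → v ∈ S → All (λ t → E v (root t) ≡ true) ts → All (Along E) ts →
                     (∀ {x} → x ∈ₗ flattenForest ts → x ∈ S) →
                     ∀ {x} → x ∈ₗ flattenForest ts → Walk S (restrict E S) v x
  walk-from-root (node v ts) (node adj along) ⊆S (here refl) = here (⊆S (here refl))
  walk-from-root (node v ts) (node adj along) ⊆S (there x∈) =
    walk-from-parent ts (⊆S (here refl)) adj along (⊆S ∘ there) x∈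
  walk-from-parent (t ∷ ts) v∈S (e ∷ adj) (at ∷ along) ⊆S x∈ with ∈-++⁻ (flatten t) x∈
  ... | inj₁ x∈t =
    step v∈S (restrict⁺ {E = E} e v∈S (⊆S (∈-++⁺ˡ (root∈flatten t)))) (walk-from-root t at (⊆S ∘ ∈-++⁺ˡ) x∈t)
  ... | inj₂ x∈ts = walk-from-parent ts v∈S adj along (⊆S ∘ ∈-++⁺ʳ (flatten t)) x∈ts

IsTree-flatten : ∀ {n} {E : EdgeRel n} → (∀ i j → E i j ≡ E j i) → Acyclic ⊤ E →
                 ∀ t → Along E t → IsTree (fromList (flatten t)) (restrict E (fromList (flatten t)))
IsTree-flatten {E = E} E-sym acyclic t along =
  (root t , ∈-fromList⁺ (root∈flatten t)) ,
  (λ u v u∈ v∈ → Walk-++ (Walk-reverse (restrict-sym {S = S} E-sym) (from-root u∈)) (from-root v∈)) ,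
  acyclic ∘ Cycle-mono (λ _ → ∈⊤) (restrict-⊆ {S = S})
  where
    S : Subset _
    S = fromList (flatten t)

    from-root : ∀ {x} → x ∈ S → Walk S (restrict E S) (root t) x
    from-root x∈ = walk-from-root t along ∈-fromList⁺ (∈-fromList⁻ x∈)

module Greedy {n : ℕ} (E : EdgeRel n) (E-sym : ∀ i j → E i j ≡ E j i) (deg≤3 : ∀ v → deg E v ≤ 3)
              (X : Subset n) (deg≤2 : ∀ v → v ∈ X → deg E v ≤ 2)
              (K : ℕ) {{_ : NonZero K}} where

  open import Algebra.Properties.CommutativeSemigroup
    (CommutativeMonoid.commutativeSemigroup (++-commutativeMonoid {A = Fin n}))
    using () renaming (interchange to ++-interchange)

  weight : List (Fin n) → ℕ
  weight xs = length (filter (_∈ˢ? X) xs)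

  weight-++ : ∀ xs ys → weight (xs ++ ys) ≡ weight xs + weight ys
  weight-++ xs ys = trans (cong length (filter-++ (_∈ˢ? X) xs ys)) (length-++ (filter (_∈ˢ? X) xs))

  weight-∷ : ∀ v xs → weight (v ∷ xs) ≡ weight [ v ] + weight xs
  weight-∷ v = weight-++ [ v ]

  weight≤∣p∩X∣ : ∀ {p xs} → Unique xs → All (_∈ p) xs → weight xs ≤ ∣ p ∩ X ∣
  weight≤∣p∩X∣ {p} {xs} u xs⊆p = unique⇒length≤∣p∣ (Unique.filter⁺ (_∈ˢ? X) u) (All.tabulate in-p∩X)
    where
      in-p∩X : ∀ {x} → x ∈ₗ filter (_∈ˢ? X) xs → x ∈ p ∩ X
      in-p∩X x∈ with ∈-filter⁻ (_∈ˢ? X) x∈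
      ... | x∈xs , x∈X = x∈p∩q⁺ (All.lookup xs⊆p x∈xs , x∈X)

  ∣X∣≤weight : ∀ {xs} → (∀ v → v ∈ₗ xs) → ∣ X ∣ ≤ weight xs
  ∣X∣≤weight {xs} spans = ∣p∣≤length X (filter (_∈ˢ? X) xs) (∈-filter⁺ (_∈ˢ? X) (spans _))

  neighbours≤deg : ∀ {v cs} → Unique cs → All (λ c → E v c ≡ true) cs → length cs ≤ deg E v
  neighbours≤deg u adj = unique⇒length≤∣p∣ u (All.map (∈-tabulate⁺ _) adj)

  inner-capacity : ∀ v l → suc l ≤ deg E v → weight [ v ] + l ≤ 2
  inner-capacity v l l<deg with v ∈ˢ? X
  ... | yes v∈X = ≤-trans l<deg (deg≤2 v v∈X)
  ... | no _ = ≤-pred (≤-trans l<deg (deg≤3 v))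

  root-capacity : ∀ v l → l ≤ deg E v → weight [ v ] + l ≤ 3
  root-capacity v l l≤deg with v ∈ˢ? X
  ... | yes v∈X = s≤s (≤-trans l≤deg (deg≤2 v v∈X))
  ... | no _ = ≤-trans l≤deg (deg≤3 v)

  Heavy : Rose (Fin n) → Set
  Heavy t = suc K ≤ weight (flatten t)

  -- The vertices L of a forest, split into heavy pieces already cut off and the light subtrees
  -- `rest` still hanging at the parent (their roots satisfy Q).
  record Decomposition (Q : Fin n → Set) (m : ℕ) (L : List (Fin n)) : Set where
    field
      pieces rest : List (Rose (Fin n))
      pieces-along : All (Along E) pieces
      rest-along : All (Along E) rest
      pieces-heavy : All Heavy pieces
      rest-roots : All (Q ∘ root) rest
      partition : flattenForest pieces ++ flattenForest rest ↭ L
      rest-light : weight (flattenForest rest) ≤ m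
      bound : weight L ≤ length pieces * (2 * K) + weight (flattenForest rest)

  open Decomposition

  ∅ : ∀ {Q} → Decomposition Q 0 []
  ∅ = record
    { pieces = [] ; rest = [] ; pieces-along = [] ; rest-along = [] ; pieces-heavy = []
    ; rest-roots = [] ; partition = ↭-refl ; rest-light = z≤n ; bound = z≤n }

  _⊕_ : ∀ {Q m m′ L L′} → Decomposition Q m L → Decomposition Q m′ L′ →
        Decomposition Q (m + m′) (L ++ L′)
  _⊕_ {L = L} {L′} d d′ = record
    { pieces = pieces d ++ pieces d′
    ; rest = rest d ++ rest d′
    ; pieces-along = All.++⁺ (pieces-along d) (pieces-along d′)
    ; rest-along = All.++⁺ (rest-along d) (rest-along d′)
    ; pieces-heavy = All.++⁺ (pieces-heavy d) (pieces-heavy d′)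
    ; rest-roots = All.++⁺ (rest-roots d) (rest-roots d′)
    ; partition = partition-++
    ; rest-light = subst (_≤ _) (sym weight-rest) (+-mono-≤ (rest-light d) (rest-light d′))
    ; bound = bound-++
    }
    where
      P P′ R R′ : List (Fin n)
      P = flattenForest (pieces d)
      P′ = flattenForest (pieces d′)
      R = flattenForest (rest d)
      R′ = flattenForest (rest d′)

      weight-rest : weight (flattenForest (rest d ++ rest d′)) ≡ weight R + weight R′
      weight-rest = trans (cong weight (flattenForest-++ (rest d) (rest d′))) (weight-++ R R′)

      partition-++ : flattenForest (pieces d ++ pieces d′) ++ flattenForest (rest d ++ rest d′) ↭ L ++ L′
      partition-++ rewrite flattenForest-++ (pieces d) (pieces d′) | flattenForest-++ (rest d) (rest d′) =
        ↭-trans (++-interchange P P′ R R′) (++⁺ (partition d) (partition d′))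

      a a′ : ℕ
      a = length (pieces d)
      a′ = length (pieces d′)

      bound-++ : weight (L ++ L′) ≤
                 length (pieces d ++ pieces d′) * (2 * K) + weight (flattenForest (rest d ++ rest d′))
      bound-++ rewrite length-++ (pieces d) {pieces d′} | weight-rest = begin
        weight (L ++ L′)                                   ≡⟨ weight-++ L L′ ⟩
        weight L + weight L′                               ≤⟨ +-mono-≤ (bound d) (bound d′) ⟩
        (a * (2 * K) + weight R) + (a′ * (2 * K) + weight R′)
          ≡⟨ +-interchange (a * (2 * K)) (weight R) _ _ ⟩
        (a * (2 * K) + a′ * (2 * K)) + (weight R + weight R′)
          ≡⟨ cong (_+ (weight R + weight R′)) (*-distribʳ-+ (2 * K) a a′) ⟨
        (a + a′) * (2 * K) + (weight R + weight R′)
          ∎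
        where open ≤-Reasoning

  map-roots : ∀ {Q Q′ m L} → (∀ {x} → Q x → Q′ x) → Decomposition Q m L → Decomposition Q′ m L
  map-roots Q⇒Q′ d = record
    { pieces = pieces d ; rest = rest d ; pieces-along = pieces-along d ; rest-along = rest-along d
    ; pieces-heavy = pieces-heavy d ; rest-roots = All.map Q⇒Q′ (rest-roots d)
    ; partition = partition d ; rest-light = rest-light d ; bound = bound d }

  settle : ∀ {m L} v → Decomposition (λ c → E v c ≡ true) m L → weight [ v ] + m ≤ 2 * K →
           Decomposition (_≡ v) K (v ∷ L)
  settle {m} {L} v d capacity = cut-or-keep (suc K ≤? weight (flatten t))
    where
      open ≤-Reasoning

      P R : List (Fin n)
      P = flattenForest (pieces d)
      R = flattenForest (rest d)

      t : Rose (Fin n)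
      t = node v (rest d)

      t-fits : weight [ v ] + weight R ≤ 2 * K
      t-fits = ≤-trans (+-monoʳ-≤ _ (rest-light d)) capacity

      cut-or-keep : Dec (Heavy t) → Decomposition (_≡ v) K (v ∷ L)
      cut-or-keep (yes heavy) = record
        { pieces = t ∷ pieces d
        ; rest = []
        ; pieces-along = node (rest-roots d) (rest-along d) ∷ pieces-along d
        ; rest-along = []
        ; pieces-heavy = heavy ∷ pieces-heavy d
        ; rest-roots = []
        ; partition = ↭-trans (↭-reflexive (++-identityʳ _)) (↭-prep v (↭-trans (++-comm R P) (partition d)))
        ; rest-light = z≤n
        ; bound = begin
            weight (v ∷ L)                          ≡⟨ weight-∷ v L ⟩
            weight [ v ] + weight L                 ≤⟨ +-≤-absorb (bound d) t-fits ⟩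
            length (pieces d) * (2 * K) + 2 * K     ≡⟨ trans (+-comm _ (2 * K)) (sym (+-identityʳ _)) ⟩
            suc (length (pieces d)) * (2 * K) + 0   ∎
        }
      cut-or-keep (no light) = record
        { pieces = pieces d
        ; rest = [ t ]
        ; pieces-along = pieces-along d
        ; rest-along = node (rest-roots d) (rest-along d) ∷ []
        ; pieces-heavy = pieces-heavy d
        ; rest-roots = refl ∷ []
        ; partition = ↭-trans (↭-reflexive (cong (P ++_) flattenForest-[ t ]))
                              (↭-trans (shift v P R) (↭-prep v (partition d)))
        ; rest-light = subst (_≤ K) (cong weight (sym flattenForest-[ t ])) (≤-pred (≰⇒> light))
        ; bound = begin
            weight (v ∷ L)
              ≡⟨ weight-∷ v L ⟩
            weight [ v ] + weight L
              ≤⟨ +-≤-absorb {r = weight R} (bound d) ≤-refl ⟩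
            length (pieces d) * (2 * K) + (weight [ v ] + weight R)
              ≡⟨ cong (length (pieces d) * (2 * K) +_) (trans (cong weight flattenForest-[ t ]) (weight-∷ v R)) ⟨
            length (pieces d) * (2 * K) + weight (flattenForest [ t ])
              ∎
        }

  decompose : ∀ {u} t → Along E t → Unique (u ∷ flatten t) → E (root t) u ≡ true →
              Decomposition (_≡ root t) K (flatten t)
  decomposeForest : ∀ v ts → All (Along E) ts → All (λ t → E v (root t) ≡ true) ts →
                    Unique (v ∷ flattenForest ts) →
                    Decomposition (λ c → E v c ≡ true) (length ts * K) (flattenForest ts)
  decompose {u} (node v ts) (node adj along) (u∉ ∷ uniq@(_ ∷ uniq-ts)) vu =
    settle v (decomposeForest v ts along adj uniq)
             (+-≤-scale (weight [ v ]) (length ts) 2 K (inner-capacity v (length ts) degree))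
    where
      parent-fresh : All (u ≢_) (map root ts)
      parent-fresh = All.tabulate (λ r∈ → All.lookup (All.tail u∉) (root∈flattenForest ts r∈))

      degree : suc (length ts) ≤ deg E v
      degree = subst (λ l → suc l ≤ deg E v) (length-map root ts)
                     (neighbours≤deg (parent-fresh ∷ Unique-roots ts uniq-ts) (vu ∷ All.map⁺ adj))
  decomposeForest v [] [] [] _ = ∅
  decomposeForest v (t ∷ ts) (at ∷ along) (vt ∷ adj) uniq with Unique-∷-++⁻ v (flatten t) uniq
  ... | uniq-t , uniq-ts =
    map-roots (λ { refl → vt }) (decompose t at uniq-t (trans (E-sym (root t) v) vt))
    ⊕ decomposeForest v ts along adj uniq-ts

  record Packing (L : List (Fin n)) : Set where
    field
      pieces : List (Rose (Fin n))
      pieces-along : All (Along E) pieces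
      pieces-heavy : All Heavy pieces
      pieces-disjoint : Unique (flattenForest pieces)
      bound : weight L ≤ (2 * length pieces + 1) * K

  pack : ∀ t → Along E t → Unique (flatten t) → Packing (flatten t)
  pack (node r ts) (node adj along) uniq@(_ ∷ uniq-ts) = cut-or-keep (suc K ≤? weight (flatten t))
    where
      open ≤-Reasoning

      d : Decomposition (λ c → E r c ≡ true) (length ts * K) (flattenForest ts)
      d = decomposeForest r ts along adj uniq

      P R : List (Fin n)
      P = flattenForest (pieces d)
      R = flattenForest (rest d)

      t : Rose (Fin n)
      t = node r (rest d)

      degree : length ts ≤ deg E r
      degree = subst (_≤ deg E r) (length-map root ts) (neighbours≤deg (Unique-roots ts uniq-ts) (All.map⁺ adj))

      capacity : weight [ r ] + weight R ≤ 3 * K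
      capacity = ≤-trans (+-monoʳ-≤ _ (rest-light d))
                         (+-≤-scale (weight [ r ]) (length ts) 3 K (root-capacity r (length ts) degree))

      cut-or-keep : Dec (Heavy t) → Packing (r ∷ flattenForest ts)
      cut-or-keep (yes heavy) = record
        { pieces = t ∷ pieces d
        ; pieces-along = node (rest-roots d) (rest-along d) ∷ pieces-along d
        ; pieces-heavy = heavy ∷ pieces-heavy d
        ; pieces-disjoint = Unique-resp-↭ (↭-prep r (↭-trans (↭-sym (partition d)) (++-comm P R))) uniq
        ; bound = begin
            weight (r ∷ flattenForest ts)             ≡⟨ weight-∷ r (flattenForest ts) ⟩
            weight [ r ] + weight (flattenForest ts)   ≤⟨ +-≤-absorb (bound d) capacity ⟩
            length (pieces d) * (2 * K) + 3 * K        ≡⟨ regroup (length (pieces d)) K ⟩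
            (2 * suc (length (pieces d)) + 1) * K      ∎
        }
        where
          regroup : ∀ a K → a * (2 * K) + 3 * K ≡ (2 * (1 + a) + 1) * K
          regroup = solve-∀
      cut-or-keep (no light) = record
        { pieces = pieces d
        ; pieces-along = pieces-along d
        ; pieces-heavy = pieces-heavy d
        ; pieces-disjoint = proj₁ (Unique-++⁻ P (Unique-resp-↭ (↭-sym (partition d)) uniq-ts))
        ; bound = begin
            weight (r ∷ flattenForest ts)             ≡⟨ weight-∷ r (flattenForest ts) ⟩
            weight [ r ] + weight (flattenForest ts)   ≤⟨ +-≤-absorb (bound d) light′ ⟩
            length (pieces d) * (2 * K) + K            ≡⟨ regroup (length (pieces d)) K ⟩
            (2 * length (pieces d) + 1) * K            ∎
        }
        where
          light′ : weight [ r ] + weight R ≤ K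
          light′ = subst (_≤ K) (weight-∷ r R) (≤-pred (≰⇒> light))

          regroup : ∀ a K → a * (2 * K) + K ≡ (2 * a + 1) * K
          regroup = solve-∀

  heavy⇒valid-piece : Acyclic ⊤ E → ∀ t → Along E t → Unique (flatten t) → Heavy t →
                IsSubgraph E (fromList (flatten t)) (restrict E (fromList (flatten t))) ×
                IsTree (fromList (flatten t)) (restrict E (fromList (flatten t))) ×
                suc K ≤ ∣ fromList (flatten t) ∩ X ∣
  heavy⇒valid-piece acyclic t along uniq heavy =
    IsSubgraph-restrict E-sym , IsTree-flatten E-sym acyclic t along ,
    ≤-trans heavy (weight≤∣p∩X∣ uniq (All.tabulate ∈-fromList⁺))

lemma6p2 : (p k : ℕ) → 2 ≤ k →
    (n : ℕ) (E : EdgeRel n) → IsSimpleGraph E → IsTree ⊤ E →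
    (∀ v → deg E v ≤ 3) →
    (X : Subset n) → (∀ v → v ∈ X → deg E v ≤ 2) →
    (2 * p + 1) * (k ∸ 1) ≤ ∣ X ∣ →
    Σ (Fin p → Subset n) λ S → Σ (Fin p → EdgeRel n) λ F →
    (∀ i → IsSubgraph E (S i) (F i) × IsTree (S i) (F i) × k ≤ ∣ S i ∩ X ∣) ×
    (∀ i j → i ≢ j → Empty (S i ∩ S j))
lemma6p2 p (suc (suc j)) (s≤s (s≤s z≤n)) n E (E-sym , _) (nonempty , connected , acyclic) deg≤3 X deg≤2 X-large
  with spanning-tree E connected nonempty
... | T , T-along , T-unique , T-spans = S , F , valid , disjoint
  where
    open Greedy E E-sym deg≤3 X deg≤2 (suc j) using (Packing; pack; ∣X∣≤weight; heavy⇒valid-piece)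
    open Packing (pack T T-along T-unique)

    p≤ : p ≤ length pieces
    p≤ = [2p+1]*K≤[2q+1]*K⇒p≤q p (length pieces) (suc j)
           (≤-trans X-large (≤-trans (∣X∣≤weight T-spans) bound))

    index : Fin p → Fin (length pieces)
    index i = inject≤ i p≤

    piece : Fin p → Rose (Fin n)
    piece i = List.lookup pieces (index i)

    S : Fin p → Subset n
    S i = fromList (flatten (piece i))

    F : Fin p → EdgeRel n
    F i = restrict E (S i)

    valid : ∀ i → IsSubgraph E (S i) (F i) × IsTree (S i) (F i) × suc (suc j) ≤ ∣ S i ∩ X ∣
    valid i = heavy⇒valid-piece acyclic (piece i) (All.lookup pieces-along (∈-lookup (index i)))
                (Unique-flatten-lookup pieces pieces-disjoint (index i))
                (All.lookup pieces-heavy (∈-lookup (index i)))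

    disjoint : ∀ i i′ → i ≢ i′ → Empty (S i ∩ S i′)
    disjoint i i′ i≢i′ (x , x∈S∩S′) with x∈p∩q⁻ (S i) (S i′) x∈S∩S′
    ... | x∈S , x∈S′ =
      Disjoint-flatten-lookup pieces pieces-disjoint (index i) (index i′) (i≢i′ ∘ inject≤-injective p≤ p≤ i i′)
        (∈-fromList⁻ x∈S , ∈-fromList⁻ x∈S′)
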